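{- Let $m$ be an odd positive integer, $p=2q$ an even positive integer, and $n=m+p$. Let $B$ be an $m\times m$ matrix in $\Omega_m^{t\&h}$ and let \[C=\begin{bmatrix}C_1&C_2\\ C_2^t&C_1^h\end{bmatrix}\] be a matrix in $\Omega_p^{t\&h}$, where $C_1,C_2$ are $q\times q$. Define \[A=\begin{bmatrix}C_1&O_{q\times m}&C_2\\ O_{m\times q}&B&O_{m\times q}\\ C_2^t&O_{q\times m}&C_1^h\end{bmatrix}.\] If $B$ is an extreme point of $\Omega_m^{t\&h}$ and $C$ is an extreme point of $\Omega_p^{t\&h}$, then $A$ is an extreme point of $\Omega_n^{t\&h}$. Conversely, if $A$ is an extreme point of $\Omega_n^{t\&h}$, then $C$ is an extreme point of $\Omega_p^{t\&h}$ and $B$ is an extreme point of $\Omega_m^{t\&h}$.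
   Context: For a $k\times k$ matrix $X=[x_{ij}]$, $X^t$ is the transpose and the Hankel transpose $X^h$ has $(i,j)$ entry $x_{k+1-j,k+1-i}$; $X$ is Hankel-symmetric if $X^h=X$. $\Omega_k^{t\&h}$ is the convex polytope of all $k\times k$ doubly stochastic matrices (nonnegative, all row and column sums $1$) that are both symmetric and Hankel-symmetric. $O_{a\times b}$ denotes the $a\times b$ zero matrix.
   Formalization: The matrices B, $C_1$, $C_2$ have rational entries, and so do the competing matrices and the weight in the convex combinations that define an extreme point. -}

module Defs where

open import Data.Nat using (ℕ; zero; suc)
import Data.Nat as ℕ
open import Data.Fin using (Fin; zero; suc; opposite; splitAt)
open import Data.Sum using (_⊎_; inj₁; inj₂)
open import Data.Product using (_×_; Σ)
open import Data.Rational using (ℚ; 0ℚ; 1ℚ; _+_; _*_; _-_; _≤_; _<_)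
open import Relation.Binary.PropositionalEquality using (_≡_)

Mat : ℕ → ℕ → Set
Mat k l = Fin k → Fin l → ℚ

Σ[_] : ∀ {k} → (Fin k → ℚ) → ℚ
Σ[_] {zero}  f = 0ℚ
Σ[_] {suc k} f = f zero + Σ[_] (λ i → f (suc i))

_ᵗ : ∀ {k l} → Mat k l → Mat l k
(X ᵗ) i j = X j i

-- Hankel transpose: (X^h)_{ij} = x_{k+1-j, k+1-i}  (opposite i = k-1-i, 0-based)
_ʰ : ∀ {k l} → Mat k l → Mat l k
(X ʰ) i j = X (opposite j) (opposite i)

O : ∀ a b → Mat a b
O a b i j = 0ℚ

DoublyStochastic : ∀ {k} → Mat k k → Set
DoublyStochastic {k} X =
  (∀ i j → 0ℚ ≤ X i j) ×
  (∀ i → Σ[ (λ j → X i j) ] ≡ 1ℚ) ×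
  (∀ j → Σ[ (λ i → X i j) ] ≡ 1ℚ)

Ωth : ∀ k → Mat k k → Set
Ωth k X = DoublyStochastic X × (∀ i j → (X ᵗ) i j ≡ X i j) × (∀ i j → (X ʰ) i j ≡ X i j)

Extreme : ∀ k → Mat k k → Set
Extreme k X =
  Ωth k X ×
  (∀ (Y Z : Mat k k) (λ′ : ℚ) → Ωth k Y → Ωth k Z → 0ℚ < λ′ → λ′ < 1ℚ →
     (∀ i j → X i j ≡ λ′ * Y i j + (1ℚ - λ′) * Z i j) →
     ∀ i j → Y i j ≡ Z i j)

block2 : ∀ {a b} → Mat a a → Mat a b → Mat b a → Mat b b → Mat (a ℕ.+ b) (a ℕ.+ b)
block2 {a} P Q R S i j with splitAt a i | splitAt a j
... | inj₁ i′ | inj₁ j′ = P i′ j′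
... | inj₁ i′ | inj₂ j′ = Q i′ j′
... | inj₂ i′ | inj₁ j′ = R i′ j′
... | inj₂ i′ | inj₂ j′ = S i′ j′

matC : ∀ {q} → Mat q q → Mat q q → Mat (q ℕ.+ q) (q ℕ.+ q)
matC C₁ C₂ = block2 C₁ C₂ (C₂ ᵗ) (C₁ ʰ)

matA : ∀ {q m} → Mat q q → Mat q q → Mat m m → Mat (q ℕ.+ (m ℕ.+ q)) (q ℕ.+ (m ℕ.+ q))
matA {q} {m} C₁ C₂ B i j with splitAt q i | splitAt q j
... | inj₁ i′ | inj₁ j′ = C₁ i′ j′
... | inj₁ i′ | inj₂ j′ with splitAt m j′
...   | inj₁ _  = 0ℚ
...   | inj₂ j″ = C₂ i′ j″
matA {q} {m} C₁ C₂ B i j | inj₂ i′ | inj₁ j′ with splitAt m i′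
...   | inj₁ _  = 0ℚ
...   | inj₂ i″ = (C₂ ᵗ) i″ j′
matA {q} {m} C₁ C₂ B i j | inj₂ i′ | inj₂ j′ with splitAt m i′ | splitAt m j′
...   | inj₁ i″ | inj₁ j″ = B i″ j″
...   | inj₁ _  | inj₂ _  = 0ℚ
...   | inj₂ _  | inj₁ _  = 0ℚ
...   | inj₂ i″ | inj₂ j″ = (C₁ ʰ) i″ j″

{-# OPTIONS --safe #-}
module Submission where

-- Listing the 2q outer indices of A first and the m middle ones last turns A into the
-- block-diagonal matrix diag(C, B), and this relabelling commutes with the reflection
-- i ↦ n + 1 − i, so transpose and Hankel transpose act blockwise.  Hence the matrices of
-- Ω_n^{t&h} with vanishing off-diagonal blocks are exactly the diag(X, W) with X ∈ Ω_p^{t&h}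
-- and W ∈ Ω_m^{t&h}.  By nonnegativity they form a face: if diag(X, W) = λY + (1 − λ)Z with
-- 0 < λ < 1 then Y and Z are block-diagonal as well.  So diag(X, W) is extreme iff X and W are.

open import Defs
open import Data.Nat using (ℕ; _+_; _*_; _%_; _≤_)
open import Data.Product using (_×_)
open import Relation.Binary.PropositionalEquality using (_≡_)

open import Data.Nat using (zero; suc; _∸_)
import Data.Nat.Properties as ℕ
open import Data.Product using (_,_; proj₁; proj₂)
open import Data.Sum using (_⊎_; inj₁; inj₂; [_,_]; [_,_]′)
import Data.Sum as Sum
open import Data.Fin using (Fin; zero; suc; toℕ; opposite; splitAt; join; _↑ˡ_; _↑ʳ_)
open import Data.Fin.Properties
  using (toℕ-injective; toℕ-↑ˡ; toℕ-↑ʳ; toℕ<n; opposite-prop; opposite-suc; splitAt-↑ˡ; splitAt-↑ʳ; join-splitAt)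
open import Data.Rational using (ℚ; 0ℚ; 1ℚ; positive; nonNegative)
  renaming (_+_ to _+ℚ_; _*_ to _*ℚ_; _-_ to _-ℚ_; _≤_ to _≤ℚ_; _<_ to _<ℚ_; -_ to -ℚ_)
import Data.Rational.Properties as ℚ
open import Data.Rational.Solver using (module +-*-Solver)
open import Algebra.Bundles using (CommutativeMonoid)
open import Algebra.Properties.CommutativeSemigroup (CommutativeMonoid.commutativeSemigroup ℚ.+-0-commutativeMonoid) using (x∙yz≈xz∙y)
open import Function using (_∘_)
open import Relation.Binary.PropositionalEquality using (refl; sym; trans; cong; cong₂; subst; subst₂; module ≡-Reasoning)

nonNeg+nonNeg≡0⇒≡0 : ∀ {p q} → 0ℚ ≤ℚ p → 0ℚ ≤ℚ q → p +ℚ q ≡ 0ℚ → p ≡ 0ℚ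
nonNeg+nonNeg≡0⇒≡0 {p} {q} 0≤p 0≤q p+q≡0 = ℚ.≤-antisym p≤0 0≤p
  where
  p≤0 : p ≤ℚ 0ℚ
  p≤0 = subst (p ≤ℚ_) p+q≡0 (subst (_≤ℚ p +ℚ q) (ℚ.+-identityʳ p) (ℚ.+-monoʳ-≤ p 0≤q))

pos*nonNeg≡0⇒≡0 : ∀ {r p} → 0ℚ <ℚ r → 0ℚ ≤ℚ p → r *ℚ p ≡ 0ℚ → p ≡ 0ℚ
pos*nonNeg≡0⇒≡0 {r} {p} 0<r 0≤p rp≡0 = ℚ.≤-antisym p≤0 0≤p
  where
  p≤0 : p ≤ℚ 0ℚ
  p≤0 = ℚ.*-cancelˡ-≤-pos r {{positive 0<r}} (ℚ.≤-reflexive (trans rp≡0 (sym (ℚ.*-zeroʳ r))))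

pos*nonNeg≥0 : ∀ {r p} → 0ℚ <ℚ r → 0ℚ ≤ℚ p → 0ℚ ≤ℚ r *ℚ p
pos*nonNeg≥0 {r} {p} 0<r 0≤p =
  subst (_≤ℚ r *ℚ p) (ℚ.*-zeroʳ r) (ℚ.*-monoˡ-≤-nonNeg r {{nonNegative (ℚ.<⇒≤ 0<r)}} 0≤p)

p<1⇒0<1-p : ∀ {p} → p <ℚ 1ℚ → 0ℚ <ℚ 1ℚ -ℚ p
p<1⇒0<1-p {p} p<1 = subst (_<ℚ 1ℚ -ℚ p) (ℚ.+-inverseʳ p) (ℚ.+-monoˡ-< (-ℚ p) p<1)

convex-≡0 : ∀ {t y z} → 0ℚ <ℚ t → t <ℚ 1ℚ → 0ℚ ≤ℚ y → 0ℚ ≤ℚ z →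
  0ℚ ≡ t *ℚ y +ℚ (1ℚ -ℚ t) *ℚ z → y ≡ 0ℚ × z ≡ 0ℚ
convex-≡0 {t} {y} {z} 0<t t<1 0≤y 0≤z 0≡ty+sz =
  pos*nonNeg≡0⇒≡0 0<t 0≤y (nonNeg+nonNeg≡0⇒≡0 0≤ty 0≤sz (sym 0≡ty+sz)) ,
  pos*nonNeg≡0⇒≡0 0<s 0≤z (nonNeg+nonNeg≡0⇒≡0 0≤sz 0≤ty (trans (ℚ.+-comm _ (t *ℚ y)) (sym 0≡ty+sz)))
  where
  0<s : 0ℚ <ℚ 1ℚ -ℚ t
  0<s = p<1⇒0<1-p t<1
  0≤ty : 0ℚ ≤ℚ t *ℚ y
  0≤ty = pos*nonNeg≥0 0<t 0≤y
  0≤sz : 0ℚ ≤ℚ (1ℚ -ℚ t) *ℚ z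
  0≤sz = pos*nonNeg≥0 0<s 0≤z

convex-idem : ∀ t x → x ≡ t *ℚ x +ℚ (1ℚ -ℚ t) *ℚ x
convex-idem = solve 2 (λ t x → x := t :* x :+ (con 1ℚ :- t) :* x) refl
  where open +-*-Solver

Σ-cong : ∀ {k} {f g : Fin k → ℚ} → (∀ i → f i ≡ g i) → Σ[ f ] ≡ Σ[ g ]
Σ-cong {zero}  f≗g = refl
Σ-cong {suc k} f≗g = cong₂ _+ℚ_ (f≗g zero) (Σ-cong (f≗g ∘ suc))

Σ-≡0 : ∀ {k} {f : Fin k → ℚ} → (∀ i → f i ≡ 0ℚ) → Σ[ f ] ≡ 0ℚ
Σ-≡0 {zero}  f≡0 = refl
Σ-≡0 {suc k} f≡0 = trans (cong₂ _+ℚ_ (f≡0 zero) (Σ-≡0 (f≡0 ∘ suc))) (ℚ.+-identityˡ 0ℚ)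

Σ-splitAt : ∀ m n (f : Fin (m + n) → ℚ) → Σ[ f ] ≡ Σ[ f ∘ (_↑ˡ n) ] +ℚ Σ[ f ∘ (m ↑ʳ_) ]
Σ-splitAt zero    n f = sym (ℚ.+-identityˡ Σ[ f ])
Σ-splitAt (suc m) n f = trans (cong (f zero +ℚ_) (Σ-splitAt m n (f ∘ suc)))
  (sym (ℚ.+-assoc (f zero) Σ[ f ∘ suc ∘ (_↑ˡ n) ] Σ[ f ∘ suc ∘ (m ↑ʳ_) ]))

↑-elim : ∀ m {n} (P : Fin (m + n) → Set) → (∀ i → P (i ↑ˡ n)) → (∀ j → P (m ↑ʳ j)) → ∀ k → P k
↑-elim m {n} P left right k = subst P (join-splitAt m n k) ([_,_] {C = P ∘ join m n} left right (splitAt m k))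

toℕ-opposite-↑ˡ : ∀ {m} n (i : Fin m) → toℕ (opposite (i ↑ˡ n)) ≡ n + toℕ (opposite i)
toℕ-opposite-↑ˡ {m} n i = begin
  toℕ (opposite (i ↑ˡ n))    ≡⟨ opposite-prop (i ↑ˡ n) ⟩
  m + n ∸ suc (toℕ (i ↑ˡ n)) ≡⟨ cong (λ x → m + n ∸ suc x) (toℕ-↑ˡ i n) ⟩
  m + n ∸ suc (toℕ i)        ≡⟨ ℕ.+-∸-comm n (toℕ<n i) ⟩
  m ∸ suc (toℕ i) + n        ≡⟨ ℕ.+-comm (m ∸ suc (toℕ i)) n ⟩
  n + (m ∸ suc (toℕ i))      ≡⟨ cong (n +_) (opposite-prop i) ⟨
  n + toℕ (opposite i)       ∎
  where open ≡-Reasoning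

toℕ-opposite-↑ʳ : ∀ m {n} (j : Fin n) → toℕ (opposite (m ↑ʳ j)) ≡ toℕ (opposite j)
toℕ-opposite-↑ʳ zero    j = refl
toℕ-opposite-↑ʳ (suc m) j = trans (opposite-suc (m ↑ʳ j)) (toℕ-opposite-↑ʳ m j)

opposite-↑ˡ : ∀ {n} (i : Fin n) → opposite (i ↑ˡ n) ≡ n ↑ʳ opposite i
opposite-↑ˡ {n} i = toℕ-injective (trans (toℕ-opposite-↑ˡ n i) (sym (toℕ-↑ʳ n (opposite i))))

opposite-↑ʳ : ∀ {n} (j : Fin n) → opposite (n ↑ʳ j) ≡ opposite j ↑ˡ n
opposite-↑ʳ {n} j = toℕ-injective (trans (toℕ-opposite-↑ʳ n j) (sym (toℕ-↑ˡ (opposite j) n)))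

_≗₂_ : ∀ {k l} → Mat k l → Mat k l → Set
X ≗₂ Y = ∀ i j → X i j ≡ Y i j

≗₂-sym : ∀ {k l} {X Y : Mat k l} → X ≗₂ Y → Y ≗₂ X
≗₂-sym X≗Y i j = sym (X≗Y i j)

convexComb : ∀ {k l} → ℚ → Mat k l → Mat k l → Mat k l
convexComb t Y Z i j = t *ℚ Y i j +ℚ (1ℚ -ℚ t) *ℚ Z i j

convexComb-idem : ∀ {k l} t (X : Mat k l) → X ≗₂ convexComb t X X
convexComb-idem t X i j = convex-idem t (X i j)

restrict : ∀ {a n} → (Fin a → Fin n) → Mat n n → Mat a a
restrict e Y i j = Y (e i) (e j)

colSums-of-symmetric : ∀ {k} (X : Mat k k) → (∀ i j → X j i ≡ X i j) →
  (∀ i → Σ[ X i ] ≡ 1ℚ) → ∀ j → Σ[ (λ i → X i j) ] ≡ 1ℚ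
colSums-of-symmetric X symX rows j = trans (Σ-cong (λ i → sym (symX i j))) (rows j)

Ωth-resp : ∀ {k} {X Y : Mat k k} → X ≗₂ Y → Ωth k X → Ωth k Y
Ωth-resp X≗Y ((X≥0 , rowX , colX) , symX , hankX) =
  ((λ i j → subst (0ℚ ≤ℚ_) (X≗Y i j) (X≥0 i j)) ,
   (λ i → trans (sym (Σ-cong (X≗Y i))) (rowX i)) ,
   (λ j → trans (sym (Σ-cong (λ i → X≗Y i j))) (colX j))) ,
  (λ i j → trans (sym (X≗Y j i)) (trans (symX i j) (X≗Y i j))) ,
  (λ i j → trans (sym (X≗Y (opposite j) (opposite i))) (trans (hankX i j) (X≗Y i j)))

Extreme-resp : ∀ {k} {X Y : Mat k k} → X ≗₂ Y → Extreme k X → Extreme k Y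
Extreme-resp X≗Y (ΩX , extX) =
  Ωth-resp X≗Y ΩX ,
  λ V W t ΩV ΩW 0<t t<1 Y≗VW → extX V W t ΩV ΩW 0<t t<1 (λ i j → trans (X≗Y i j) (Y≗VW i j))

Ωth-restrict : ∀ {a n} {Y : Mat n n} (e : Fin a → Fin n) →
  (∀ i → opposite (e i) ≡ e (opposite i)) →
  (∀ i → Σ[ Y (e i) ] ≡ Σ[ restrict e Y i ]) →
  Ωth n Y → Ωth a (restrict e Y)
Ωth-restrict {Y = Y} e opposite-e rows-supported ((Y≥0 , rowY , _) , symY , hankY) =
  (nonNeg , rows , colSums-of-symmetric (restrict e Y) symmetric rows) , symmetric , hankel
  where
  nonNeg : ∀ i j → 0ℚ ≤ℚ restrict e Y i j
  nonNeg i j = Y≥0 (e i) (e j)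
  rows : ∀ i → Σ[ restrict e Y i ] ≡ 1ℚ
  rows i = trans (sym (rows-supported i)) (rowY (e i))
  symmetric : ∀ i j → restrict e Y j i ≡ restrict e Y i j
  symmetric i j = symY (e i) (e j)
  hankel : ∀ i j → restrict e Y (opposite j) (opposite i) ≡ restrict e Y i j
  hankel i j = trans (sym (cong₂ Y (opposite-e j) (opposite-e i))) (hankY (e i) (e j))

diag⊎ : ∀ {a b} → Mat a a → Mat b b → Fin a ⊎ Fin b → Fin a ⊎ Fin b → ℚ
diag⊎ X W (inj₁ i) (inj₁ j) = X i j
diag⊎ X W (inj₁ i) (inj₂ j) = 0ℚ
diag⊎ X W (inj₂ i) (inj₁ j) = 0ℚ
diag⊎ X W (inj₂ i) (inj₂ j) = W i j

module _ {a b} {X : Mat a a} {W : Mat b b} where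

  diag⊎-nonNeg : (∀ i j → 0ℚ ≤ℚ X i j) → (∀ i j → 0ℚ ≤ℚ W i j) → ∀ s t → 0ℚ ≤ℚ diag⊎ X W s t
  diag⊎-nonNeg X≥0 W≥0 (inj₁ i) (inj₁ j) = X≥0 i j
  diag⊎-nonNeg X≥0 W≥0 (inj₁ i) (inj₂ j) = ℚ.≤-refl
  diag⊎-nonNeg X≥0 W≥0 (inj₂ i) (inj₁ j) = ℚ.≤-refl
  diag⊎-nonNeg X≥0 W≥0 (inj₂ i) (inj₂ j) = W≥0 i j

  diag⊎-symmetric : (∀ i j → X j i ≡ X i j) → (∀ i j → W j i ≡ W i j) →
    ∀ s t → diag⊎ X W t s ≡ diag⊎ X W s t
  diag⊎-symmetric symX symW (inj₁ i) (inj₁ j) = symX i j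
  diag⊎-symmetric symX symW (inj₁ i) (inj₂ j) = refl
  diag⊎-symmetric symX symW (inj₂ i) (inj₁ j) = refl
  diag⊎-symmetric symX symW (inj₂ i) (inj₂ j) = symW i j

  diag⊎-hankel : (∀ i j → X (opposite j) (opposite i) ≡ X i j) → (∀ i j → W (opposite j) (opposite i) ≡ W i j) →
    ∀ s t → diag⊎ X W (Sum.map opposite opposite t) (Sum.map opposite opposite s) ≡ diag⊎ X W s t
  diag⊎-hankel hankX hankW (inj₁ i) (inj₁ j) = hankX i j
  diag⊎-hankel hankX hankW (inj₁ i) (inj₂ j) = refl
  diag⊎-hankel hankX hankW (inj₂ i) (inj₁ j) = refl
  diag⊎-hankel hankX hankW (inj₂ i) (inj₂ j) = hankW i j

diag⊎-convexComb : ∀ {a b} t {X X₁ X₂ : Mat a a} {W W₁ W₂ : Mat b b} →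
  X ≗₂ convexComb t X₁ X₂ → W ≗₂ convexComb t W₁ W₂ →
  ∀ s u → diag⊎ X W s u ≡ t *ℚ diag⊎ X₁ W₁ s u +ℚ (1ℚ -ℚ t) *ℚ diag⊎ X₂ W₂ s u
diag⊎-convexComb t X≗ W≗ (inj₁ i) (inj₁ j) = X≗ i j
diag⊎-convexComb t X≗ W≗ (inj₁ i) (inj₂ j) = convex-idem t 0ℚ
diag⊎-convexComb t X≗ W≗ (inj₂ i) (inj₁ j) = convex-idem t 0ℚ
diag⊎-convexComb t X≗ W≗ (inj₂ i) (inj₂ j) = W≗ i j

record Splitting (a b n : ℕ) : Set where
  field
    ι₁ : Fin a → Fin n
    ι₂ : Fin b → Fin n
    locate : Fin n → Fin a ⊎ Fin b
    locate-ι₁ : ∀ i → locate (ι₁ i) ≡ inj₁ i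
    locate-ι₂ : ∀ j → locate (ι₂ j) ≡ inj₂ j
    ι-locate : ∀ k → [ ι₁ , ι₂ ]′ (locate k) ≡ k
    Σ-ι : ∀ f → Σ[ f ] ≡ Σ[ f ∘ ι₁ ] +ℚ Σ[ f ∘ ι₂ ]
    opposite-ι₁ : ∀ i → opposite (ι₁ i) ≡ ι₁ (opposite i)
    opposite-ι₂ : ∀ j → opposite (ι₂ j) ≡ ι₂ (opposite j)

module BlockDiagonal {a b n} (S : Splitting a b n) where
  open Splitting S

  blockDiag : Mat a a → Mat b b → Mat n n
  blockDiag X W k l = diag⊎ X W (locate k) (locate l)

  OffDiagonalZero : Mat n n → Set
  OffDiagonalZero Y = (∀ i j → Y (ι₁ i) (ι₂ j) ≡ 0ℚ) × (∀ j i → Y (ι₂ j) (ι₁ i) ≡ 0ℚ)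

  Σ-locate : (g : Fin a ⊎ Fin b → ℚ) → Σ[ g ∘ locate ] ≡ Σ[ g ∘ inj₁ ] +ℚ Σ[ g ∘ inj₂ ]
  Σ-locate g = trans (Σ-ι (g ∘ locate)) (cong₂ _+ℚ_ (Σ-cong (cong g ∘ locate-ι₁)) (Σ-cong (cong g ∘ locate-ι₂)))

  locate-opposite : ∀ k → locate (opposite k) ≡ Sum.map opposite opposite (locate k)
  locate-opposite k = trans (cong (locate ∘ opposite) (sym (ι-locate k))) (locate-opposite-ι (locate k))
    where
    locate-opposite-ι : ∀ s → locate (opposite ([ ι₁ , ι₂ ]′ s)) ≡ Sum.map opposite opposite s
    locate-opposite-ι (inj₁ i) = trans (cong locate (opposite-ι₁ i)) (locate-ι₁ (opposite i))
    locate-opposite-ι (inj₂ j) = trans (cong locate (opposite-ι₂ j)) (locate-ι₂ (opposite j))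

  module _ {X : Mat a a} {W : Mat b b} where

    restrict-ι₁-blockDiag : restrict ι₁ (blockDiag X W) ≗₂ X
    restrict-ι₁-blockDiag i j = cong₂ (diag⊎ X W) (locate-ι₁ i) (locate-ι₁ j)

    restrict-ι₂-blockDiag : restrict ι₂ (blockDiag X W) ≗₂ W
    restrict-ι₂-blockDiag i j = cong₂ (diag⊎ X W) (locate-ι₂ i) (locate-ι₂ j)

    blockDiag-offDiagonalZero : OffDiagonalZero (blockDiag X W)
    blockDiag-offDiagonalZero =
      (λ i j → cong₂ (diag⊎ X W) (locate-ι₁ i) (locate-ι₂ j)) ,
      (λ j i → cong₂ (diag⊎ X W) (locate-ι₂ j) (locate-ι₁ i))

    Ωth-blockDiag : Ωth a X → Ωth b W → Ωth n (blockDiag X W)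
    Ωth-blockDiag ((X≥0 , rowX , _) , symX , hankX) ((W≥0 , rowW , _) , symW , hankW) =
      (nonNeg , rows , colSums-of-symmetric (blockDiag X W) symmetric rows) , symmetric , hankel
      where
      nonNeg : ∀ k l → 0ℚ ≤ℚ blockDiag X W k l
      nonNeg k l = diag⊎-nonNeg X≥0 W≥0 (locate k) (locate l)
      rowSum : ∀ s → Σ[ diag⊎ X W s ∘ inj₁ ] +ℚ Σ[ diag⊎ X W s ∘ inj₂ ] ≡ 1ℚ
      rowSum (inj₁ i) = trans (cong₂ _+ℚ_ (rowX i) (Σ-≡0 {b} (λ _ → refl))) (ℚ.+-identityʳ 1ℚ)
      rowSum (inj₂ j) = trans (cong₂ _+ℚ_ (Σ-≡0 {a} (λ _ → refl)) (rowW j)) (ℚ.+-identityˡ 1ℚ)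
      rows : ∀ k → Σ[ blockDiag X W k ] ≡ 1ℚ
      rows k = trans (Σ-locate (diag⊎ X W (locate k))) (rowSum (locate k))
      symmetric : ∀ k l → blockDiag X W l k ≡ blockDiag X W k l
      symmetric k l = diag⊎-symmetric symX symW (locate k) (locate l)
      hankel : ∀ k l → blockDiag X W (opposite l) (opposite k) ≡ blockDiag X W k l
      hankel k l = trans (cong₂ (diag⊎ X W) (locate-opposite l) (locate-opposite k))
        (diag⊎-hankel hankX hankW (locate k) (locate l))

  blockDiag-convexComb : ∀ t {X X₁ X₂ : Mat a a} {W W₁ W₂ : Mat b b} →
    X ≗₂ convexComb t X₁ X₂ → W ≗₂ convexComb t W₁ W₂ →
    blockDiag X W ≗₂ convexComb t (blockDiag X₁ W₁) (blockDiag X₂ W₂)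
  blockDiag-convexComb t X≗ W≗ k l = diag⊎-convexComb t X≗ W≗ (locate k) (locate l)

  offDiagonalZero-ext : ∀ {Y Z : Mat n n} → OffDiagonalZero Y → OffDiagonalZero Z →
    restrict ι₁ Y ≗₂ restrict ι₁ Z → restrict ι₂ Y ≗₂ restrict ι₂ Z → Y ≗₂ Z
  offDiagonalZero-ext {Y} {Z} (Y₁₂≡0 , Y₂₁≡0) (Z₁₂≡0 , Z₂₁≡0) Y₁≗Z₁ Y₂≗Z₂ k l =
    subst₂ (λ k l → Y k l ≡ Z k l) (ι-locate k) (ι-locate l) (blockwise (locate k) (locate l))
    where
    blockwise : ∀ s u → Y ([ ι₁ , ι₂ ]′ s) ([ ι₁ , ι₂ ]′ u) ≡ Z ([ ι₁ , ι₂ ]′ s) ([ ι₁ , ι₂ ]′ u)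
    blockwise (inj₁ i) (inj₁ j) = Y₁≗Z₁ i j
    blockwise (inj₁ i) (inj₂ j) = trans (Y₁₂≡0 i j) (sym (Z₁₂≡0 i j))
    blockwise (inj₂ j) (inj₁ i) = trans (Y₂₁≡0 j i) (sym (Z₂₁≡0 j i))
    blockwise (inj₂ i) (inj₂ j) = Y₂≗Z₂ i j

  Ωth-restrict-ι₁ : ∀ {Y} → OffDiagonalZero Y → Ωth n Y → Ωth a (restrict ι₁ Y)
  Ωth-restrict-ι₁ {Y} (Y₁₂≡0 , _) = Ωth-restrict ι₁ opposite-ι₁ λ i →
    trans (Σ-ι (Y (ι₁ i))) (trans (cong (Σ[ restrict ι₁ Y i ] +ℚ_) (Σ-≡0 (Y₁₂≡0 i))) (ℚ.+-identityʳ _))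

  Ωth-restrict-ι₂ : ∀ {Y} → OffDiagonalZero Y → Ωth n Y → Ωth b (restrict ι₂ Y)
  Ωth-restrict-ι₂ {Y} (_ , Y₂₁≡0) = Ωth-restrict ι₂ opposite-ι₂ λ j →
    trans (Σ-ι (Y (ι₂ j))) (trans (cong (_+ℚ Σ[ restrict ι₂ Y j ]) (Σ-≡0 (Y₂₁≡0 j))) (ℚ.+-identityˡ _))

  offDiagonalZero-face : ∀ {V Y Z : Mat n n} {t} → 0ℚ <ℚ t → t <ℚ 1ℚ →
    (∀ k l → 0ℚ ≤ℚ Y k l) → (∀ k l → 0ℚ ≤ℚ Z k l) → V ≗₂ convexComb t Y Z →
    OffDiagonalZero V → OffDiagonalZero Y × OffDiagonalZero Z
  offDiagonalZero-face {V} {Y} {Z} 0<t t<1 Y≥0 Z≥0 V≗YZ (V₁₂≡0 , V₂₁≡0) =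
    ((λ i j → proj₁ (zeros (V₁₂≡0 i j))) , (λ j i → proj₁ (zeros (V₂₁≡0 j i)))) ,
    ((λ i j → proj₂ (zeros (V₁₂≡0 i j))) , (λ j i → proj₂ (zeros (V₂₁≡0 j i))))
    where
    zeros : ∀ {k l} → V k l ≡ 0ℚ → Y k l ≡ 0ℚ × Z k l ≡ 0ℚ
    zeros {k} {l} V≡0 = convex-≡0 0<t t<1 (Y≥0 k l) (Z≥0 k l) (trans (sym V≡0) (V≗YZ k l))

  Extreme-blockDiag : ∀ {X W} → Extreme a X → Extreme b W → Extreme n (blockDiag X W)
  Extreme-blockDiag {X} {W} (ΩX , extX) (ΩW , extW) = Ωth-blockDiag ΩX ΩW , ext
    where
    ext : ∀ Y Z t → Ωth n Y → Ωth n Z → 0ℚ <ℚ t → t <ℚ 1ℚ →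
      blockDiag X W ≗₂ convexComb t Y Z → Y ≗₂ Z
    ext Y Z t ΩY ΩZ 0<t t<1 XW≗YZ = offDiagonalZero-ext offY offZ Y₁≗Z₁ Y₂≗Z₂
      where
      offYZ : OffDiagonalZero Y × OffDiagonalZero Z
      offYZ = offDiagonalZero-face 0<t t<1 (proj₁ (proj₁ ΩY)) (proj₁ (proj₁ ΩZ)) XW≗YZ blockDiag-offDiagonalZero
      offY : OffDiagonalZero Y
      offY = proj₁ offYZ
      offZ : OffDiagonalZero Z
      offZ = proj₂ offYZ
      Y₁≗Z₁ : restrict ι₁ Y ≗₂ restrict ι₁ Z
      Y₁≗Z₁ = extX (restrict ι₁ Y) (restrict ι₁ Z) t (Ωth-restrict-ι₁ offY ΩY) (Ωth-restrict-ι₁ offZ ΩZ) 0<t t<1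
        λ i j → trans (sym (restrict-ι₁-blockDiag i j)) (XW≗YZ (ι₁ i) (ι₁ j))
      Y₂≗Z₂ : restrict ι₂ Y ≗₂ restrict ι₂ Z
      Y₂≗Z₂ = extW (restrict ι₂ Y) (restrict ι₂ Z) t (Ωth-restrict-ι₂ offY ΩY) (Ωth-restrict-ι₂ offZ ΩZ) 0<t t<1
        λ i j → trans (sym (restrict-ι₂-blockDiag i j)) (XW≗YZ (ι₂ i) (ι₂ j))

  Extreme-blockDiag⁻¹ : ∀ {X W} → Extreme n (blockDiag X W) → Extreme a X × Extreme b W
  Extreme-blockDiag⁻¹ {X} {W} (Ω , ext) = (ΩX , extX) , (ΩW , extW)
    where
    ΩX : Ωth a X
    ΩX = Ωth-resp restrict-ι₁-blockDiag (Ωth-restrict-ι₁ blockDiag-offDiagonalZero Ω)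
    ΩW : Ωth b W
    ΩW = Ωth-resp restrict-ι₂-blockDiag (Ωth-restrict-ι₂ blockDiag-offDiagonalZero Ω)
    extX : ∀ Y Z t → Ωth a Y → Ωth a Z → 0ℚ <ℚ t → t <ℚ 1ℚ → X ≗₂ convexComb t Y Z → Y ≗₂ Z
    extX Y Z t ΩY ΩZ 0<t t<1 X≗YZ i j = begin
      Y i j                       ≡⟨ restrict-ι₁-blockDiag i j ⟨
      blockDiag Y W (ι₁ i) (ι₁ j) ≡⟨ YW≗ZW (ι₁ i) (ι₁ j) ⟩
      blockDiag Z W (ι₁ i) (ι₁ j) ≡⟨ restrict-ι₁-blockDiag i j ⟩
      Z i j                       ∎
      where
      open ≡-Reasoning
      YW≗ZW : blockDiag Y W ≗₂ blockDiag Z W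
      YW≗ZW = ext (blockDiag Y W) (blockDiag Z W) t (Ωth-blockDiag ΩY ΩW) (Ωth-blockDiag ΩZ ΩW) 0<t t<1
        (blockDiag-convexComb t X≗YZ (convexComb-idem t W))
    extW : ∀ Y Z t → Ωth b Y → Ωth b Z → 0ℚ <ℚ t → t <ℚ 1ℚ → W ≗₂ convexComb t Y Z → Y ≗₂ Z
    extW Y Z t ΩY ΩZ 0<t t<1 W≗YZ i j = begin
      Y i j                       ≡⟨ restrict-ι₂-blockDiag i j ⟨
      blockDiag X Y (ι₂ i) (ι₂ j) ≡⟨ XY≗XZ (ι₂ i) (ι₂ j) ⟩
      blockDiag X Z (ι₂ i) (ι₂ j) ≡⟨ restrict-ι₂-blockDiag i j ⟩
      Z i j                       ∎
      where
      open ≡-Reasoning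
      XY≗XZ : blockDiag X Y ≗₂ blockDiag X Z
      XY≗XZ = ext (blockDiag X Y) (blockDiag X Z) t (Ωth-blockDiag ΩX ΩY) (Ωth-blockDiag ΩX ΩZ) 0<t t<1
        (blockDiag-convexComb t (convexComb-idem t X) W≗YZ)

module OuterInner (q m : ℕ) where

  outerLeft : Fin q → Fin (q + (m + q))
  outerLeft i = i ↑ˡ (m + q)

  outerRight : Fin q → Fin (q + (m + q))
  outerRight c = q ↑ʳ (m ↑ʳ c)

  outer : Fin (q + q) → Fin (q + (m + q))
  outer i = [ outerLeft , outerRight ]′ (splitAt q i)

  inner : Fin m → Fin (q + (m + q))
  inner j = q ↑ʳ (j ↑ˡ q)

  locate : Fin (q + (m + q)) → Fin (q + q) ⊎ Fin m
  locate k = [ (λ i → inj₁ (i ↑ˡ q)) , (λ k′ → [ inj₂ , (λ c → inj₁ (q ↑ʳ c)) ]′ (splitAt m k′)) ]′ (splitAt q k)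

  outer-↑ˡ : ∀ i → outer (i ↑ˡ q) ≡ outerLeft i
  outer-↑ˡ i = cong [ outerLeft , outerRight ]′ (splitAt-↑ˡ q i q)

  outer-↑ʳ : ∀ c → outer (q ↑ʳ c) ≡ outerRight c
  outer-↑ʳ c = cong [ outerLeft , outerRight ]′ (splitAt-↑ʳ q q c)

  locate-outer : ∀ i → locate (outer i) ≡ inj₁ i
  locate-outer = ↑-elim q (λ i → locate (outer i) ≡ inj₁ i) left right
    where
    left : ∀ i → locate (outer (i ↑ˡ q)) ≡ inj₁ (i ↑ˡ q)
    left i rewrite outer-↑ˡ i | splitAt-↑ˡ q i (m + q) = refl
    right : ∀ c → locate (outer (q ↑ʳ c)) ≡ inj₁ (q ↑ʳ c)
    right c rewrite outer-↑ʳ c | splitAt-↑ʳ q (m + q) (m ↑ʳ c) | splitAt-↑ʳ m q c = refl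

  locate-inner : ∀ j → locate (inner j) ≡ inj₂ j
  locate-inner j rewrite splitAt-↑ʳ q (m + q) (j ↑ˡ q) | splitAt-↑ˡ m j q = refl

  outer-inner-locate : ∀ k → [ outer , inner ]′ (locate k) ≡ k
  outer-inner-locate = ↑-elim q (λ k → [ outer , inner ]′ (locate k) ≡ k) left
    (↑-elim m (λ k → [ outer , inner ]′ (locate (q ↑ʳ k)) ≡ q ↑ʳ k) middle right)
    where
    left : ∀ i → [ outer , inner ]′ (locate (outerLeft i)) ≡ outerLeft i
    left i rewrite splitAt-↑ˡ q i (m + q) = outer-↑ˡ i
    middle : ∀ j → [ outer , inner ]′ (locate (inner j)) ≡ inner j
    middle j rewrite locate-inner j = refl
    right : ∀ c → [ outer , inner ]′ (locate (outerRight c)) ≡ outerRight c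
    right c rewrite splitAt-↑ʳ q (m + q) (m ↑ʳ c) | splitAt-↑ʳ m q c = outer-↑ʳ c

  Σ-outer-inner : ∀ f → Σ[ f ] ≡ Σ[ f ∘ outer ] +ℚ Σ[ f ∘ inner ]
  Σ-outer-inner f = begin
    Σ[ f ]                                                         ≡⟨ Σ-splitAt q (m + q) f ⟩
    Σ[ f ∘ outerLeft ] +ℚ Σ[ f ∘ (q ↑ʳ_) ]                         ≡⟨ cong (Σ[ f ∘ outerLeft ] +ℚ_) (Σ-splitAt m q (f ∘ (q ↑ʳ_))) ⟩
    Σ[ f ∘ outerLeft ] +ℚ (Σ[ f ∘ inner ] +ℚ Σ[ f ∘ outerRight ]) ≡⟨ x∙yz≈xz∙y Σ[ f ∘ outerLeft ] _ _ ⟩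
    Σ[ f ∘ outerLeft ] +ℚ Σ[ f ∘ outerRight ] +ℚ Σ[ f ∘ inner ]   ≡⟨ cong (_+ℚ Σ[ f ∘ inner ]) Σ-outer ⟨
    Σ[ f ∘ outer ] +ℚ Σ[ f ∘ inner ]                               ∎
    where
    open ≡-Reasoning
    Σ-outer : Σ[ f ∘ outer ] ≡ Σ[ f ∘ outerLeft ] +ℚ Σ[ f ∘ outerRight ]
    Σ-outer = trans (Σ-splitAt q q (f ∘ outer)) (cong₂ _+ℚ_ (Σ-cong (cong f ∘ outer-↑ˡ)) (Σ-cong (cong f ∘ outer-↑ʳ)))

  opposite-outerLeft : ∀ i → opposite (outerLeft i) ≡ outerRight (opposite i)
  opposite-outerLeft i = toℕ-injective (begin
    toℕ (opposite (i ↑ˡ (m + q)))   ≡⟨ toℕ-opposite-↑ˡ (m + q) i ⟩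
    m + q + toℕ (opposite i)        ≡⟨ cong (_+ toℕ (opposite i)) (ℕ.+-comm m q) ⟩
    q + m + toℕ (opposite i)        ≡⟨ ℕ.+-assoc q m (toℕ (opposite i)) ⟩
    q + (m + toℕ (opposite i))      ≡⟨ cong (q +_) (toℕ-↑ʳ m (opposite i)) ⟨
    q + toℕ (m ↑ʳ opposite i)       ≡⟨ toℕ-↑ʳ q (m ↑ʳ opposite i) ⟨
    toℕ (outerRight (opposite i))   ∎)
    where open ≡-Reasoning

  opposite-outerRight : ∀ c → opposite (outerRight c) ≡ outerLeft (opposite c)
  opposite-outerRight c = toℕ-injective (begin
    toℕ (opposite (q ↑ʳ (m ↑ʳ c)))  ≡⟨ toℕ-opposite-↑ʳ q (m ↑ʳ c) ⟩
    toℕ (opposite (m ↑ʳ c))         ≡⟨ toℕ-opposite-↑ʳ m c ⟩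
    toℕ (opposite c)                ≡⟨ toℕ-↑ˡ (opposite c) (m + q) ⟨
    toℕ (outerLeft (opposite c))    ∎)
    where open ≡-Reasoning

  opposite-inner : ∀ j → opposite (inner j) ≡ inner (opposite j)
  opposite-inner j = toℕ-injective (begin
    toℕ (opposite (q ↑ʳ (j ↑ˡ q)))  ≡⟨ toℕ-opposite-↑ʳ q (j ↑ˡ q) ⟩
    toℕ (opposite (j ↑ˡ q))         ≡⟨ toℕ-opposite-↑ˡ q j ⟩
    q + toℕ (opposite j)            ≡⟨ cong (q +_) (toℕ-↑ˡ (opposite j) q) ⟨
    q + toℕ (opposite j ↑ˡ q)       ≡⟨ toℕ-↑ʳ q (opposite j ↑ˡ q) ⟨
    toℕ (inner (opposite j))        ∎)
    where open ≡-Reasoning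

  opposite-outer : ∀ i → opposite (outer i) ≡ outer (opposite i)
  opposite-outer = ↑-elim q (λ i → opposite (outer i) ≡ outer (opposite i)) left right
    where
    open ≡-Reasoning
    left : ∀ i → opposite (outer (i ↑ˡ q)) ≡ outer (opposite (i ↑ˡ q))
    left i = begin
      opposite (outer (i ↑ˡ q))   ≡⟨ cong opposite (outer-↑ˡ i) ⟩
      opposite (outerLeft i)      ≡⟨ opposite-outerLeft i ⟩
      outerRight (opposite i)     ≡⟨ outer-↑ʳ (opposite i) ⟨
      outer (q ↑ʳ opposite i)     ≡⟨ cong outer (opposite-↑ˡ i) ⟨
      outer (opposite (i ↑ˡ q))   ∎
    right : ∀ c → opposite (outer (q ↑ʳ c)) ≡ outer (opposite (q ↑ʳ c))
    right c = begin
      opposite (outer (q ↑ʳ c))   ≡⟨ cong opposite (outer-↑ʳ c) ⟩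
      opposite (outerRight c)     ≡⟨ opposite-outerRight c ⟩
      outerLeft (opposite c)      ≡⟨ outer-↑ˡ (opposite c) ⟨
      outer (opposite c ↑ˡ q)     ≡⟨ cong outer (opposite-↑ʳ c) ⟨
      outer (opposite (q ↑ʳ c))   ∎

  splitting : Splitting (q + q) m (q + (m + q))
  splitting = record
    { ι₁ = outer
    ; ι₂ = inner
    ; locate = locate
    ; locate-ι₁ = locate-outer
    ; locate-ι₂ = locate-inner
    ; ι-locate = outer-inner-locate
    ; Σ-ι = Σ-outer-inner
    ; opposite-ι₁ = opposite-outer
    ; opposite-ι₂ = opposite-inner
    }

  open BlockDiagonal splitting using (blockDiag)

  matA≗blockDiag : (C₁ C₂ : Mat q q) (B : Mat m m) → matA C₁ C₂ B ≗₂ blockDiag (matC C₁ C₂) B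
  matA≗blockDiag C₁ C₂ B k l with splitAt q k | splitAt q l
  ... | inj₁ i | inj₁ j rewrite splitAt-↑ˡ q i q | splitAt-↑ˡ q j q = refl
  ... | inj₁ i | inj₂ l′ with splitAt m l′
  ...   | inj₁ _ = refl
  ...   | inj₂ c rewrite splitAt-↑ˡ q i q | splitAt-↑ʳ q q c = refl
  matA≗blockDiag C₁ C₂ B k l | inj₂ k′ | inj₁ j with splitAt m k′
  ...   | inj₁ _ = refl
  ...   | inj₂ c rewrite splitAt-↑ʳ q q c | splitAt-↑ˡ q j q = refl
  matA≗blockDiag C₁ C₂ B k l | inj₂ k′ | inj₂ l′ with splitAt m k′ | splitAt m l′
  ...   | inj₁ _ | inj₁ _ = refl
  ...   | inj₁ _ | inj₂ _ = refl
  ...   | inj₂ _ | inj₁ _ = refl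
  ...   | inj₂ c | inj₂ c′ rewrite splitAt-↑ʳ q q c | splitAt-↑ʳ q q c′ = refl

lemma3p15 : (m q : ℕ) → m % 2 ≡ 1 → 1 ≤ q →
    (B : Mat m m) (C₁ C₂ : Mat q q) →
    Ωth m B → Ωth (q + q) (matC C₁ C₂) →
    ((Extreme m B × Extreme (q + q) (matC C₁ C₂)) → Extreme (q + (m + q)) (matA C₁ C₂ B))
    × (Extreme (q + (m + q)) (matA C₁ C₂ B) → Extreme (q + q) (matC C₁ C₂) × Extreme m B)
lemma3p15 m q _ _ B C₁ C₂ _ _ =
  (λ (extB , extC) → Extreme-resp (≗₂-sym A≗CB) (Extreme-blockDiag extC extB)) ,
  (λ extA → Extreme-blockDiag⁻¹ (Extreme-resp A≗CB extA))
  where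
  open OuterInner q m using (splitting; matA≗blockDiag)
  open BlockDiagonal splitting using (blockDiag; Extreme-blockDiag; Extreme-blockDiag⁻¹)
  A≗CB : matA C₁ C₂ B ≗₂ blockDiag (matC C₁ C₂) B
  A≗CB = matA≗blockDiag C₁ C₂ B
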